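{- For every positive integer $n$, the state complex of the robotic arm $SR_n$ is isomorphic (as a cubical complex) to the state complex of the system of hopping repellent particles on a board of length $n$.
   Context: The robotic arm $SR_n$: $n$ unit links attached sequentially, in the strip $[0,n]\times[0,1]$, base at $(0,0)$, each link facing north, south or east, never revisiting a point. A position is labelled by the set $A$ of indices of vertical links; these are exactly the spread-out subsets of $[n]$ (no two consecutive integers). Moves: corner switch at $i$ ($1\le i\le n-1$): links $i,i+1$ facing different directions interchange directions, provided the result is a valid position; end flip: the last link rotates $90^\circ$ between horizontal and vertical, provided the result is valid. Hopping repellent particles on a board of length $n$: indistinguishable particles occupy slots of a board of $n$ slots on a line, any two at distance at least $2$; a state is the (spread-out) set of occupied slots. A particle may hop to an adjacent slot if that slot and its other neighbour are empty; a particle may enter onto the rightmost slot $n$ or leave from slot $n$, provided the distance condition is kept. For both systems, a move between positions/slots $i$ and $i+1$ (a corner switch of links $i,i+1$, resp. a hop between slots $i,i+1$) changes $\{i,i+1\}$ and involves $\{i-1,i,i+1,i+2\}\cap[n]$, and an end move (end flip, resp. entering/leaving) changes $\{n\}$ and involves $\{n-1,n\}\cap[n]$; two moves commute if what each changes is disjoint from what the other involves. The state complex of such a system is the cubical complex whose vertices are the states and where, for each state $u$ and each set of $k$ pairwise commuting moves applicable at $u$, the $2^k$ states obtained by applying subsets of these moves to $u$ span a $k$-cube; cubes are glued along common faces. -}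

module Defs where

open import Data.Bool using (Bool; true; false; T; _∧_; not; if_then_else_)
open import Data.Nat using (ℕ; zero; suc; _+_; _∸_; _≤_; _<_; _≡ᵇ_)
open import Data.Integer as ℤ using (ℤ)
open import Data.Product using (Σ; ∃; _×_; _,_; proj₁)
open import Data.Product.Properties using (≡-dec)
open import Data.Sum using (_⊎_)
open import Data.Empty using (⊥)
open import Data.Maybe using (Maybe; just; nothing)
open import Data.List using (List; []; _∷_; map)
open import Data.Vec using (Vec; toList)
open import Data.List.Membership.Propositional using (_∈_)
open import Data.List.Relation.Unary.All using (All)
open import Data.List.Relation.Unary.AllPairs using (AllPairs)
open import Data.List.Relation.Binary.Sublist.Propositional using (_⊆_)
open import Relation.Binary.PropositionalEquality using (_≡_; _≢_)
open import Relation.Nullary.Decidable using (⌊_⌋)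
open import Function.Bundles using (_↔_; _⇔_; Inverse)
import Data.Nat.Properties as ℕP
import Data.Integer.Properties as ℤP

-- 1-indexed reading of a list / vector (nothing outside positions 1..n)

at : {A : Set} → List A → ℕ → Maybe A
at xs zero = nothing
at [] (suc k) = nothing
at (x ∷ xs) (suc zero) = just x
at (x ∷ xs) (suc (suc k)) = at xs (suc k)

-- hop i : corner switch of links i,i+1 / hop between slots i,i+1
-- end   : end flip / entering or leaving at slot n
data Move : Set where
  hop : ℕ → Move
  end : Move

Changes : ℕ → Move → ℕ → Set
Changes n (hop i) j = j ≡ i ⊎ j ≡ suc i
Changes n end     j = j ≡ n

Involves : ℕ → Move → ℕ → Set
Involves n (hop i) j = 1 ≤ j × j ≤ n × i ≤ suc j × j ≤ i + 2
Involves n end     j = 1 ≤ j × j ≤ n × n ≤ suc j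

Disjoint : (ℕ → Set) → (ℕ → Set) → Set
Disjoint P Q = ∀ j → P j → Q j → ⊥

Commute : ℕ → Move → Move → Set
Commute n m m' = Disjoint (Changes n m) (Involves n m')
               × Disjoint (Changes n m') (Involves n m)

record System : Set₁ where
  field
    len   : ℕ
    State : Set
    Step  : Move → State → State → Set

module _ (Sy : System) where
  open System Sy

  Steps : List Move → State → State → Set
  Steps []       u v = u ≡ v
  Steps (m ∷ ms) u v = ∃ λ w → Step m u w × Steps ms w v

  CubeData : State → List Move → Set
  CubeData u M = AllPairs (Commute len) M × All (λ m → ∃ λ v → Step m u v) M

  -- P (a finite set of states, as a list) is the vertex set of a cube:
  -- the states obtained by applying subsets of M to u
  IsCube : List State → Set
  IsCube P = ∃ λ u → ∃ λ M → CubeData u M ×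
               (∀ x → (x ∈ P) ⇔ (∃ λ S → S ⊆ M × Steps S u x))

CubicalIso : System → System → Set
CubicalIso S₁ S₂ =
  Σ (System.State S₁ ↔ System.State S₂) λ f →
    ∀ (P : List (System.State S₁)) →
      IsCube S₁ P ⇔ IsCube S₂ (map (Inverse.to f) P)

-- slot occupancy (positions outside 1..n are empty)
occ : {n : ℕ} → Vec Bool n → ℕ → Bool
occ b j with at (toList b) j
... | just x  = x
... | nothing = false

spreadOutB : List Bool → Bool
spreadOutB []                = true
spreadOutB (x ∷ [])          = true
spreadOutB (true ∷ true ∷ _) = false
spreadOutB (x ∷ y ∷ xs)      = spreadOutB (y ∷ xs)

ParticleState : ℕ → Set
ParticleState n = Σ (Vec Bool n) λ b → T (spreadOutB (toList b))

_≟ℕ_ : ℕ → ℕ → Bool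
_≟ℕ_ = _≡ᵇ_

ParticleStep : (n : ℕ) → Move → ParticleState n → ParticleState n → Set
ParticleStep n (hop i) (u , _) (v , _) =
  1 ≤ i × i < n ×
  (
    (occ u i ≡ true × occ u (suc i) ≡ false × occ u (i + 2) ≡ false ×
     (∀ j → occ v j ≡ (if j ≟ℕ i then false else if j ≟ℕ suc i then true else occ u j)))
  ⊎
    (occ u (suc i) ≡ true × occ u i ≡ false × occ u (i ∸ 1) ≡ false ×
     (∀ j → occ v j ≡ (if j ≟ℕ i then true else if j ≟ℕ suc i then false else occ u j))))
ParticleStep n end (u , _) (v , _) =
  1 ≤ n ×
  (
    (occ u n ≡ false × occ u (n ∸ 1) ≡ false ×
     (∀ j → occ v j ≡ (if j ≟ℕ n then true else occ u j)))
  ⊎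
    (occ u n ≡ true ×
     (∀ j → occ v j ≡ (if j ≟ℕ n then false else occ u j))))

particles : ℕ → System
particles n = record { len = n ; State = ParticleState n ; Step = ParticleStep n }

data Dir : Set where
  N S E : Dir

Point : Set
Point = ℕ × ℤ

move : Point → Dir → Point
move (x , y) N = (x , y ℤ.+ ℤ.+ 1)
move (x , y) S = (x , y ℤ.- ℤ.+ 1)
move (x , y) E = (suc x , y)

points : Point → List Dir → List Point
points p []       = p ∷ []
points p (d ∷ ds) = p ∷ points (move p d) ds

inStrip : Point → Bool
inStrip (x , y) = ⌊ ℤP._≤?_ (ℤ.+ 0) y ⌋ ∧ ⌊ ℤP._≤?_ y (ℤ.+ 1) ⌋

_≟P_ : (p q : Point) → Bool
p ≟P q = ⌊ ≡-dec ℕP._≟_ ℤP._≟_ p q ⌋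

notIn : Point → List Point → Bool
notIn p []       = true
notIn p (q ∷ qs) = not (p ≟P q) ∧ notIn p qs

allInStrip : List Point → Bool
allInStrip []       = true
allInStrip (p ∷ ps) = inStrip p ∧ allInStrip ps

distinct : List Point → Bool
distinct []       = true
distinct (p ∷ ps) = notIn p ps ∧ distinct ps

validArm : List Dir → Bool
validArm ds = allInStrip (points (0 , ℤ.+ 0) ds) ∧ distinct (points (0 , ℤ.+ 0) ds)

ArmState : ℕ → Set
ArmState n = Σ (Vec Dir n) λ ds → T (validArm (toList ds))

dir : {n : ℕ} → Vec Dir n → ℕ → Maybe Dir
dir ds j = at (toList ds) j

data Rot90 : Dir → Dir → Set where
  EN : Rot90 E N
  ES : Rot90 E S
  NE : Rot90 N E
  SE : Rot90 S E

ArmStep : (n : ℕ) → Move → ArmState n → ArmState n → Set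
ArmStep n (hop i) (u , _) (v , _) =
  1 ≤ i × i < n × dir u i ≢ dir u (suc i) ×
  (∀ j → dir v j ≡ (if j ≟ℕ i then dir u (suc i)
                    else if j ≟ℕ suc i then dir u i else dir u j))
ArmStep n end (u , _) (v , _) =
  1 ≤ n ×
  (∃ λ a → ∃ λ b → dir u n ≡ just a × dir v n ≡ just b × Rot90 a b) ×
  (∀ j → j ≢ n → dir v j ≡ dir u j)

arm : ℕ → System
arm n = record { len = n ; State = ArmState n ; Step = ArmStep n }

-- A position of SR_n is determined by its set of vertical links: at a
-- vertical link the arm passes to the other row of the strip, so the links
-- can be read back from the set and the starting row.  Two consecutive
-- vertical links either leave the strip or revisit a point, so the set is
-- spread out, and every spread-out set arises.  Under this bijection a
-- corner switch of a horizontal and a vertical link is a particle hop, and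
-- an end flip is a particle entering or leaving slot n.  Both systems carry
-- the same move labels and the same commutation relation, so a bijection of
-- states that preserves moves carries cubes exactly to cubes.
module Submission where

open import Data.Bool using (Bool; true; false; T; not; _∧_; if_then_else_)
open import Data.Bool.Properties using (T-≡; T-irrelevant; ¬-not)
open import Data.Integer as ℤ using (ℤ)
open import Data.List as List using ([]; _∷_)
open import Data.List.Membership.Propositional using (_∈_)
open import Data.List.Membership.Propositional.Properties using (∈-map⁺; ∈-map⁻)
open import Data.List.Properties using (map-∘; map-cong; map-id)
import Data.List.Relation.Unary.All as All
open import Data.List.Relation.Unary.AllPairs using (AllPairs)
open import Data.Maybe using (just; nothing; maybe′; fromMaybe)
open import Data.Maybe.Properties using (just-injective)
open import Data.Nat using (ℕ; zero; suc; _+_; _≤_; _<_; s≤s; z≤n)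
import Data.Nat.Properties as ℕP
import Data.Integer.Properties as ℤP
open import Data.Product using (Σ; ∃; _×_; _,_; proj₁)
open import Data.Product.Properties using (≡-dec)
open import Data.Sum using (inj₁; inj₂)
open import Data.Unit using (tt)
open import Data.Vec as Vec using (Vec; []; _∷_; toList)
open import Function using (_∘_)
open import Function.Bundles using (_↔_; _⇔_; Inverse; Equivalence; mk⇔; mk↔ₛ′)
import Function.Properties.Equivalence as ⇔
open import Function.Properties.Inverse using (↔-sym)
open import Relation.Binary.Definitions using (tri<; tri≈; tri>)
open import Relation.Binary.PropositionalEquality
open ≡-Reasoning
open import Relation.Nullary using (yes; no; contradiction)
open import Relation.Nullary.Decidable using (fromWitnessFalse; toWitnessFalse)

open import Defs

open Equivalence using (to; from)

-- Move-preserving bijections are isomorphisms of state complexes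

PreservesSteps : (S₁ S₂ : System) → System.State S₁ ↔ System.State S₂ → Set
PreservesSteps S₁ S₂ f =
  ∀ m u v → System.Step S₁ m u v ⇔ System.Step S₂ m (Inverse.to f u) (Inverse.to f v)

module _ {S₁ S₂ : System} (f : System.State S₁ ↔ System.State S₂) where
  open Inverse f using (strictlyInverseˡ; strictlyInverseʳ) renaming (to to f⁺; from to f⁻)

  preservesSteps-sym : PreservesSteps S₁ S₂ f → PreservesSteps S₂ S₁ (↔-sym f)
  preservesSteps-sym pres m a b = mk⇔
    (λ s → from (pres m (f⁻ a) (f⁻ b))
                (subst₂ (System.Step S₂ m) (sym (strictlyInverseˡ a)) (sym (strictlyInverseˡ b)) s))
    (λ s → subst₂ (System.Step S₂ m) (strictlyInverseˡ a) (strictlyInverseˡ b)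
                  (to (pres m (f⁻ a) (f⁻ b)) s))

  steps-map : PreservesSteps S₁ S₂ f →
              ∀ ms u v → Steps S₁ ms u v → Steps S₂ ms (f⁺ u) (f⁺ v)
  steps-map pres []       u v u≡v          = cong f⁺ u≡v
  steps-map pres (m ∷ ms) u v (w , s , ss) = f⁺ w , to (pres m u w) s , steps-map pres ms w v ss

  ∈-map⇔ : ∀ P y → (y ∈ List.map f⁺ P) ⇔ (f⁻ y ∈ P)
  ∈-map⇔ P y = mk⇔
    (λ y∈ → let (x , x∈P , y≡fx) = ∈-map⁻ f⁺ y∈
            in subst (_∈ P) (trans (sym (strictlyInverseʳ x)) (cong f⁻ (sym y≡fx))) x∈P)
    (λ f⁻y∈P → subst (_∈ List.map f⁺ P) (strictlyInverseˡ y) (∈-map⁺ f⁺ f⁻y∈P))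

  map-from-to : ∀ P → List.map f⁻ (List.map f⁺ P) ≡ P
  map-from-to P = trans (sym (map-∘ P)) (trans (map-cong strictlyInverseʳ P) (map-id P))

module _ {S₁ S₂ : System} (f : System.State S₁ ↔ System.State S₂) where
  open Inverse f using (strictlyInverseˡ; strictlyInverseʳ) renaming (to to f⁺; from to f⁻)

  isCube-map : System.len S₁ ≡ System.len S₂ → PreservesSteps S₁ S₂ f →
               ∀ P → IsCube S₁ P → IsCube S₂ (List.map f⁺ P)
  isCube-map len≡ pres P (u , M , (commuting , applicable) , spans) =
    f⁺ u , M ,
    ( subst (λ n → AllPairs (Commute n) M) len≡ commuting
    , All.map (λ (v , s) → f⁺ v , to (pres _ u v) s) applicable ) ,
    λ y → mk⇔
      (λ y∈ → let (ms , ms⊆M , ss) = to (spans (f⁻ y)) (to (∈-map⇔ {S₁} {S₂} f P y) y∈) in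
        ms , ms⊆M , subst (Steps S₂ ms (f⁺ u)) (strictlyInverseˡ y)
                          (steps-map {S₁} {S₂} f pres ms u (f⁻ y) ss))
      (λ (ms , ms⊆M , ss) → from (∈-map⇔ {S₁} {S₂} f P y) (from (spans (f⁻ y))
        (ms , ms⊆M , subst (λ w → Steps S₁ ms w (f⁻ y)) (strictlyInverseʳ u)
                           (steps-map {S₂} {S₁} (↔-sym f) (preservesSteps-sym {S₁} {S₂} f pres)
                                      ms (f⁺ u) y ss))))

cubicalIso : {S₁ S₂ : System} → System.len S₁ ≡ System.len S₂ →
             (f : System.State S₁ ↔ System.State S₂) → PreservesSteps S₁ S₂ f → CubicalIso S₁ S₂
cubicalIso {S₁} {S₂} len≡ f pres = f , λ P → mk⇔
  (isCube-map {S₁} {S₂} f len≡ pres P)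
  (subst (IsCube S₁) (map-from-to {S₁} {S₂} f P)
    ∘ isCube-map {S₂} {S₁} (↔-sym f) (sym len≡) (preservesSteps-sym {S₁} {S₂} f pres)
                 (List.map (Inverse.to f) P))

module _ {A : Set} where

  swap : {n : ℕ} → ℕ → Vec A n → Vec A n
  swap 1             (x ∷ y ∷ xs) = y ∷ x ∷ xs
  swap (suc (suc i)) (x ∷ xs)     = x ∷ swap (suc i) xs
  swap _             xs           = xs

  at-swap : ∀ {n i} → 1 ≤ i → i < n → (xs : Vec A n) → ∀ j →
            at (toList (swap i xs)) j ≡
              (if j ≟ℕ i then at (toList xs) (suc i)
               else if j ≟ℕ suc i then at (toList xs) i else at (toList xs) j)
  at-swap {i = 1}           _ _        (x ∷ y ∷ xs) 0                   = refl
  at-swap {i = 1}           _ _        (x ∷ y ∷ xs) 1                   = refl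
  at-swap {i = 1}           _ _        (x ∷ y ∷ xs) 2                   = refl
  at-swap {i = 1}           _ _        (x ∷ y ∷ xs) (suc (suc (suc j))) = refl
  at-swap {i = 1}           _ (s≤s ()) (x ∷ [])     j
  at-swap {i = suc (suc i)} _ _        (x ∷ xs)     0                   = refl
  at-swap {i = suc (suc i)} _ _        (x ∷ xs)     1                   = refl
  at-swap {i = suc (suc i)} _ (s≤s lt) (x ∷ xs)     (suc (suc j))       =
    at-swap (s≤s z≤n) lt xs (suc j)

  at-ext : ∀ {n} (xs ys : Vec A n) → (∀ j → at (toList xs) j ≡ at (toList ys) j) → xs ≡ ys
  at-ext []       []       _  = refl
  at-ext (x ∷ xs) (y ∷ ys) eq =
    cong₂ _∷_ (just-injective (eq 1)) (at-ext xs ys λ { zero → refl ; (suc j) → eq (suc (suc j)) })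

  at-inRange : ∀ {n j} → 1 ≤ j → j ≤ n → (xs : Vec A n) → ∃ λ x → at (toList xs) j ≡ just x
  at-inRange {j = 1}           _ _        (x ∷ xs) = x , refl
  at-inRange {j = suc (suc j)} _ (s≤s le) (x ∷ xs) = at-inRange (s≤s z≤n) le xs

  at-outOfRange : ∀ {n j} → n < j → (xs : Vec A n) → at (toList xs) j ≡ nothing
  at-outOfRange {j = suc j}       _        []       = refl
  at-outOfRange {j = 1}           (s≤s ()) (x ∷ xs)
  at-outOfRange {j = suc (suc j)} (s≤s lt) (x ∷ xs) = at-outOfRange lt xs

map-swap : ∀ {A B : Set} {n} (f : A → B) i (xs : Vec A n) →
           Vec.map f (swap i xs) ≡ swap i (Vec.map f xs)
map-swap f 0             xs           = refl
map-swap f 1             []           = refl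
map-swap f 1             (x ∷ [])     = refl
map-swap f 1             (x ∷ y ∷ xs) = refl
map-swap f (suc (suc i)) []           = refl
map-swap f (suc (suc i)) (x ∷ xs)     = cong (f x ∷_) (map-swap f (suc i) xs)

module _ {A : Set} where

  if-≟ℕ-refl : ∀ j {x y : A} → (if j ≟ℕ j then x else y) ≡ x
  if-≟ℕ-refl zero    = refl
  if-≟ℕ-refl (suc j) = if-≟ℕ-refl j

  if-≟ℕ-≢ : ∀ {j k} {x y : A} → j ≢ k → (if j ≟ℕ k then x else y) ≡ y
  if-≟ℕ-≢ {zero}  {zero}  j≢k = contradiction refl j≢k
  if-≟ℕ-≢ {zero}  {suc k} _   = refl
  if-≟ℕ-≢ {suc j} {zero}  _   = refl
  if-≟ℕ-≢ {suc j} {suc k} j≢k = if-≟ℕ-≢ (j≢k ∘ cong suc)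

  pointwise-update⇔ : (f g : ℕ → A) (k : ℕ) (x : A) →
                      (∀ j → g j ≡ (if j ≟ℕ k then x else f j)) ⇔
                      (g k ≡ x × (∀ j → j ≢ k → g j ≡ f j))
  pointwise-update⇔ f g k x = mk⇔
    (λ g≡ → trans (g≡ k) (if-≟ℕ-refl k) , λ j j≢k → trans (g≡ j) (if-≟ℕ-≢ j≢k))
    updated
    where
    updated : g k ≡ x × (∀ j → j ≢ k → g j ≡ f j) → ∀ j → g j ≡ (if j ≟ℕ k then x else f j)
    updated (gk≡x , elsewhere) j with j ℕP.≟ k
    ... | yes refl = trans gk≡x (sym (if-≟ℕ-refl j))
    ... | no  j≢k  = trans (elsewhere j j≢k) (sym (if-≟ℕ-≢ j≢k))

if-if-float : ∀ {A B : Set} (f : A → B) p q {x y z x′ y′ z′} →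
              f x ≡ x′ → f y ≡ y′ → f z ≡ z′ →
              f (if p then x else if q then y else z) ≡ (if p then x′ else if q then y′ else z′)
if-if-float f true  _     fx _  _  = fx
if-if-float f false true  _  fy _  = fy
if-if-float f false false _  _  fz = fz

occ≡fromMaybe : ∀ {n} (b : Vec Bool n) j → occ b j ≡ fromMaybe false (at (toList b) j)
occ≡fromMaybe b j with at (toList b) j
... | just x  = refl
... | nothing = refl

occ-∷ : ∀ {n} x (b : Vec Bool n) j → occ (x ∷ b) (suc (suc j)) ≡ occ b (suc j)
occ-∷ x b j = trans (occ≡fromMaybe (x ∷ b) (suc (suc j))) (sym (occ≡fromMaybe b (suc j)))

occ-ext : ∀ {n} (b c : Vec Bool n) → (∀ j → occ b j ≡ occ c j) → b ≡ c
occ-ext []      []      _  = refl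
occ-ext (x ∷ b) (y ∷ c) eq = cong₂ _∷_ (eq 1) (occ-ext b c λ
  { zero    → refl
  ; (suc j) → trans (sym (occ-∷ x b j)) (trans (eq (suc (suc j))) (occ-∷ y c j)) })

occ-swap : ∀ {n i} → 1 ≤ i → i < n → (b : Vec Bool n) → ∀ j →
           occ (swap i b) j ≡ (if j ≟ℕ i then occ b (suc i) else if j ≟ℕ suc i then occ b i else occ b j)
occ-swap {i = i} 1≤i i<n b j =
  trans (occ≡fromMaybe (swap i b) j)
    (trans (cong (fromMaybe false) (at-swap 1≤i i<n b j))
      (if-if-float (fromMaybe false) (j ≟ℕ i) (j ≟ℕ suc i)
         (sym (occ≡fromMaybe b (suc i))) (sym (occ≡fromMaybe b i)) (sym (occ≡fromMaybe b j))))

SpreadOut : ∀ {n} → Vec Bool n → Set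
SpreadOut b = T (spreadOutB (toList b))

spreadOutB-tail : ∀ x xs → T (spreadOutB (x ∷ xs)) → T (spreadOutB xs)
spreadOutB-tail x     []          _  = tt
spreadOutB-tail false (_ ∷ _)     so = so
spreadOutB-tail true  (false ∷ _) so = so

spreadOut-occ : ∀ {n} {b : Vec Bool n} j → SpreadOut b → occ b j ≡ true → occ b (suc j) ≡ false
spreadOut-occ {b = []}               (suc j)       _  ()
spreadOut-occ {b = x ∷ []}           1             _  _ = refl
spreadOut-occ {b = x ∷ []}           (suc (suc j)) _  ()
spreadOut-occ {b = false ∷ y ∷ b}    1             _  ()
spreadOut-occ {b = true ∷ false ∷ b} 1             _  _ = refl
spreadOut-occ {b = x ∷ y ∷ b}        (suc (suc j)) so occ-j =
  trans (occ-∷ x (y ∷ b) (suc j))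
    (spreadOut-occ {b = y ∷ b} (suc j) (spreadOutB-tail x (y ∷ toList b) so)
                   (trans (sym (occ-∷ x (y ∷ b) j)) occ-j))

spreadOut-occ′ : ∀ {n} {b : Vec Bool n} j → SpreadOut b → occ b (suc j) ≡ true → occ b j ≡ false
spreadOut-occ′ {b = b} j so occ-sj with occ b j in occ-j
... | false = refl
... | true  = contradiction (trans (sym occ-sj) (spreadOut-occ j so occ-j)) λ ()

isVertical : Dir → Bool
isVertical N = true
isVertical S = true
isVertical E = false

verticalLinks : ∀ {n} → Vec Dir n → Vec Bool n
verticalLinks = Vec.map isVertical

-- The two rows of the strip are encoded by a Bool: false for y = 0, true for y = 1.
height : Bool → ℤ
height false = ℤ.+ 0
height true  = ℤ.+ 1

verticalFrom : Bool → Dir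
verticalFrom false = N
verticalFrom true  = S

armOf : ∀ {n} → Bool → Vec Bool n → Vec Dir n
armOf h []          = []
armOf h (false ∷ b) = E ∷ armOf h b
armOf h (true ∷ b)  = verticalFrom h ∷ armOf (not h) b

isVertical-verticalFrom : ∀ h → isVertical (verticalFrom h) ≡ true
isVertical-verticalFrom false = refl
isVertical-verticalFrom true  = refl

verticalLinks-armOf : ∀ {n} h (b : Vec Bool n) → verticalLinks (armOf h b) ≡ b
verticalLinks-armOf h []          = refl
verticalLinks-armOf h (false ∷ b) = cong (false ∷_) (verticalLinks-armOf h b)
verticalLinks-armOf h (true ∷ b)  = cong₂ _∷_ (isVertical-verticalFrom h) (verticalLinks-armOf (not h) b)

occ-verticalLinks : ∀ {n} (ds : Vec Dir n) j → occ (verticalLinks ds) j ≡ maybe′ isVertical false (dir ds j)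
occ-verticalLinks ds       zero          = refl
occ-verticalLinks []       (suc j)       = refl
occ-verticalLinks (d ∷ ds) 1             = refl
occ-verticalLinks (d ∷ ds) (suc (suc j)) =
  trans (occ-∷ (isVertical d) (verticalLinks ds) j) (occ-verticalLinks ds (suc j))

-- Validity of arms is handled as `b ≡ true` rather than `T b`: `_≡_` is injective,
-- so Agda can infer the conjuncts of an `_∧_` from the proofs supplied for them.
∧-intro : ∀ {a b} → a ≡ true → b ≡ true → (a ∧ b) ≡ true
∧-intro refl refl = refl

∧-elimˡ : ∀ a {b} → (a ∧ b) ≡ true → a ≡ true
∧-elimˡ true _ = refl

∧-elimʳ : ∀ a {b} → (a ∧ b) ≡ true → b ≡ true
∧-elimʳ true b≡true = b≡true

allInStrip-head : ∀ q ds → allInStrip (points q ds) ≡ true → inStrip q ≡ true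
allInStrip-head q []      = ∧-elimˡ (inStrip q)
allInStrip-head q (_ ∷ _) = ∧-elimˡ (inStrip q)

allInStrip-step : ∀ q d ds → allInStrip (points q (d ∷ ds)) ≡ true →
                  allInStrip (points (move q d) ds) ≡ true
allInStrip-step q d ds = ∧-elimʳ (inStrip q)

allInStrip-second : ∀ q d ds → allInStrip (points q (d ∷ ds)) ≡ true → inStrip (move q d) ≡ true
allInStrip-second q d ds = allInStrip-head (move q d) ds ∘ allInStrip-step q d ds

distinct-head : ∀ q d ds → distinct (points q (d ∷ ds)) ≡ true →
                notIn q (points (move q d) ds) ≡ true
distinct-head q d ds = ∧-elimˡ (notIn q (points (move q d) ds))

distinct-step : ∀ q d ds → distinct (points q (d ∷ ds)) ≡ true →
                distinct (points (move q d) ds) ≡ true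
distinct-step q d ds = ∧-elimʳ (notIn q (points (move q d) ds))

notIn-step : ∀ p q d ds → notIn p (points q (d ∷ ds)) ≡ true →
             notIn p (points (move q d) ds) ≡ true
notIn-step p q d ds = ∧-elimʳ (not (p ≟P q))

≢⇒not-≟P : ∀ {p q} → p ≢ q → not (p ≟P q) ≡ true
≢⇒not-≟P {p} {q} p≢q = to T-≡ (fromWitnessFalse {a? = ≡-dec ℕP._≟_ ℤP._≟_ p q} p≢q)

notIn-self : ∀ p ds → notIn p (points p ds) ≢ true
notIn-self p ds p∉ = toWitnessFalse {a? = ≡-dec ℕP._≟_ ℤP._≟_ p p} (from T-≡ (first ds p∉)) refl
  where
  first : ∀ ds → notIn p (points p ds) ≡ true → not (p ≟P p) ≡ true
  first []      = ∧-elimˡ (not (p ≟P p))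
  first (_ ∷ _) = ∧-elimˡ (not (p ≟P p))

move-eastward : ∀ q d → proj₁ q ≤ proj₁ (move q d)
move-eastward (x , y) N = ℕP.≤-refl
move-eastward (x , y) S = ℕP.≤-refl
move-eastward (x , y) E = ℕP.n≤1+n x

notIn-west : ∀ {x} y q ds → x < proj₁ q → notIn (x , y) (points q ds) ≡ true
notIn-west y q []       x<q = ∧-intro (≢⇒not-≟P (ℕP.<⇒≢ x<q ∘ cong proj₁)) refl
notIn-west y q (d ∷ ds) x<q = ∧-intro (≢⇒not-≟P (ℕP.<⇒≢ x<q ∘ cong proj₁))
  (notIn-west y (move q d) ds (ℕP.<-≤-trans x<q (move-eastward q d)))

rows-differ : ∀ (x : ℕ) h → (x , height h) ≢ (x , height (not h))
rows-differ x false ()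
rows-differ x true  ()

armOf-inStrip : ∀ {n} x h (b : Vec Bool n) → allInStrip (points (x , height h) (toList (armOf h b))) ≡ true
armOf-inStrip x false []          = refl
armOf-inStrip x true  []          = refl
armOf-inStrip x false (false ∷ b) = armOf-inStrip (suc x) false b
armOf-inStrip x true  (false ∷ b) = armOf-inStrip (suc x) true b
armOf-inStrip x false (true ∷ b)  = armOf-inStrip x true b
armOf-inStrip x true  (true ∷ b)  = armOf-inStrip x false b

armOf-distinct : ∀ {n} x h (b : Vec Bool n) → SpreadOut b →
                 distinct (points (x , height h) (toList (armOf h b))) ≡ true
armOf-distinct x h     []                 _  = refl
armOf-distinct x h     (false ∷ b)        so =
  ∧-intro (notIn-west (height h) (suc x , height h) (toList (armOf h b)) (ℕP.n<1+n x))
          (armOf-distinct (suc x) h b (spreadOutB-tail false (toList b) so))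
armOf-distinct x false (true ∷ [])        _  = ∧-intro (∧-intro (≢⇒not-≟P (rows-differ x false)) refl) refl
armOf-distinct x true  (true ∷ [])        _  = ∧-intro (∧-intro (≢⇒not-≟P (rows-differ x true)) refl) refl
armOf-distinct x false (true ∷ false ∷ b) so =
  ∧-intro (∧-intro (≢⇒not-≟P (rows-differ x false))
                   (notIn-west (height false) (suc x , height true) (toList (armOf true b)) (ℕP.n<1+n x)))
          (armOf-distinct x true (false ∷ b) so)
armOf-distinct x true  (true ∷ false ∷ b) so =
  ∧-intro (∧-intro (≢⇒not-≟P (rows-differ x true))
                   (notIn-west (height true) (suc x , height false) (toList (armOf false b)) (ℕP.n<1+n x)))
          (armOf-distinct x false (false ∷ b) so)

armOf-verticalLinks : ∀ {n} x h (ds : Vec Dir n) → allInStrip (points (x , height h) (toList ds)) ≡ true →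
                      armOf h (verticalLinks ds) ≡ ds
armOf-verticalLinks x h     []       _ = refl
armOf-verticalLinks x h     (E ∷ ds) s =
  cong (E ∷_) (armOf-verticalLinks (suc x) h ds (allInStrip-step (x , height h) E (toList ds) s))
armOf-verticalLinks x false (N ∷ ds) s =
  cong (N ∷_) (armOf-verticalLinks x true ds (allInStrip-step (x , height false) N (toList ds) s))
armOf-verticalLinks x true  (S ∷ ds) s =
  cong (S ∷_) (armOf-verticalLinks x false ds (allInStrip-step (x , height true) S (toList ds) s))
armOf-verticalLinks x true  (N ∷ ds) s = contradiction (allInStrip-second (x , height true) N (toList ds) s) λ ()
armOf-verticalLinks x false (S ∷ ds) s = contradiction (allInStrip-second (x , height false) S (toList ds) s) λ ()

verticalLinks-spreadOut : ∀ {n} x h (ds : Vec Dir n) →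
                          allInStrip (points (x , height h) (toList ds)) ≡ true →
                          distinct (points (x , height h) (toList ds)) ≡ true →
                          SpreadOut (verticalLinks ds)
verticalLinks-spreadOut x h     []           _ _ = tt
verticalLinks-spreadOut x h     (_ ∷ [])     _ _ = tt
verticalLinks-spreadOut x h     (E ∷ d ∷ ds) s δ =
  verticalLinks-spreadOut (suc x) h (d ∷ ds)
    (allInStrip-step (x , height h) E (toList (d ∷ ds)) s)
    (distinct-step (x , height h) E (toList (d ∷ ds)) δ)
verticalLinks-spreadOut x false (N ∷ E ∷ ds) s δ =
  verticalLinks-spreadOut x true (E ∷ ds)
    (allInStrip-step (x , height false) N (toList (E ∷ ds)) s)
    (distinct-step (x , height false) N (toList (E ∷ ds)) δ)
verticalLinks-spreadOut x true  (S ∷ E ∷ ds) s δ =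
  verticalLinks-spreadOut x false (E ∷ ds)
    (allInStrip-step (x , height true) S (toList (E ∷ ds)) s)
    (distinct-step (x , height true) S (toList (E ∷ ds)) δ)
verticalLinks-spreadOut x false (N ∷ N ∷ ds) s _ = contradiction
  (allInStrip-second (x , height true) N (toList ds)
    (allInStrip-step (x , height false) N (toList (N ∷ ds)) s)) λ ()
verticalLinks-spreadOut x true  (S ∷ S ∷ ds) s _ = contradiction
  (allInStrip-second (x , height false) S (toList ds)
    (allInStrip-step (x , height true) S (toList (S ∷ ds)) s)) λ ()
verticalLinks-spreadOut x false (N ∷ S ∷ ds) _ δ = contradiction
  (notIn-step (x , height false) (x , height true) S (toList ds)
    (distinct-head (x , height false) N (toList (S ∷ ds)) δ))
  (notIn-self (x , height false) (toList ds))
verticalLinks-spreadOut x true  (S ∷ N ∷ ds) _ δ = contradiction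
  (notIn-step (x , height true) (x , height false) N (toList ds)
    (distinct-head (x , height true) S (toList (N ∷ ds)) δ))
  (notIn-self (x , height true) (toList ds))
verticalLinks-spreadOut x true  (N ∷ d ∷ ds) s _ =
  contradiction (allInStrip-second (x , height true) N (toList (d ∷ ds)) s) λ ()
verticalLinks-spreadOut x false (S ∷ d ∷ ds) s _ =
  contradiction (allInStrip-second (x , height false) S (toList (d ∷ ds)) s) λ ()

-- Arm positions correspond to spread-out boards

Σ-T-≡ : ∀ {A : Set} {P : A → Bool} {x y : Σ A (T ∘ P)} → proj₁ x ≡ proj₁ y → x ≡ y
Σ-T-≡ {x = a , p} {y = .a , q} refl = cong (a ,_) (T-irrelevant p q)

module _ {n : ℕ} where

  links : ArmState n → Vec Bool n
  links u = verticalLinks (proj₁ u)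

  arm-inStrip : (u : ArmState n) → allInStrip (points (0 , height false) (toList (proj₁ u))) ≡ true
  arm-inStrip (ds , valid) = ∧-elimˡ (allInStrip (points (0 , height false) (toList ds))) (to T-≡ valid)

  arm-distinct : (u : ArmState n) → distinct (points (0 , height false) (toList (proj₁ u))) ≡ true
  arm-distinct (ds , valid) = ∧-elimʳ (allInStrip (points (0 , height false) (toList ds))) (to T-≡ valid)

  armOf-links : (u : ArmState n) → armOf false (links u) ≡ proj₁ u
  armOf-links u = armOf-verticalLinks 0 false (proj₁ u) (arm-inStrip u)

  links-spreadOut : (u : ArmState n) → SpreadOut (links u)
  links-spreadOut u = verticalLinks-spreadOut 0 false (proj₁ u) (arm-inStrip u) (arm-distinct u)

  toParticles : ArmState n → ParticleState n
  toParticles u = links u , links-spreadOut u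

  toArm : ParticleState n → ArmState n
  toArm (b , so) =
    armOf false b , from T-≡ (∧-intro (armOf-inStrip 0 false b) (armOf-distinct 0 false b so))

  arm↔particles : ArmState n ↔ ParticleState n
  arm↔particles = mk↔ₛ′ toParticles toArm
    (λ c → Σ-T-≡ (verticalLinks-armOf false (proj₁ c)))
    (λ u → Σ-T-≡ (armOf-links u))

-- Corner switches are hops

Exchanges : ∀ {n} → ℕ → Vec Bool n → Vec Bool n → Set
Exchanges i b c = occ b i ≢ occ b (suc i) × c ≡ swap i b

hopped⇔swapped : ∀ {n i x y} (b c : Vec Bool n) → 1 ≤ i → i < n → occ b i ≡ x → occ b (suc i) ≡ y →
                 (∀ j → occ c j ≡ (if j ≟ℕ i then y else if j ≟ℕ suc i then x else occ b j)) ⇔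
                 (c ≡ swap i b)
hopped⇔swapped {i = i} {x} {y} b c 1≤i i<n bi bsi = mk⇔
  (λ occs → occ-ext c (swap i b) λ j → trans (occs j) (sym (swapped j)))
  (λ c≡ j → trans (cong (λ w → occ w j) c≡) (swapped j))
  where
  swapped : ∀ j → occ (swap i b) j ≡ (if j ≟ℕ i then y else if j ≟ℕ suc i then x else occ b j)
  swapped j = trans (occ-swap 1≤i i<n b j)
    (cong₂ (λ x′ y′ → if j ≟ℕ i then x′ else if j ≟ℕ suc i then y′ else occ b j) bsi bi)

-- The emptiness conditions of a particle move follow from the target board being spread out.
particleHop⇔ : ∀ {n i} (b c : ParticleState n) →
               ParticleStep n (hop i) b c ⇔ (1 ≤ i × i < n × Exchanges i (proj₁ b) (proj₁ c))
particleHop⇔ {i = zero}      _        _          = mk⇔ (λ { (() , _) }) (λ { (() , _) })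
particleHop⇔ {n} {i = suc k} (b , bo) (c , c-so) = mk⇔ forward backward
  where
  i = suc k

  forward : ParticleStep n (hop i) (b , bo) (c , c-so) → 1 ≤ i × i < n × Exchanges i b c
  forward (o , i<n , inj₁ (bi , bsi , _ , occs)) =
    o , i<n , subst₂ _≢_ (sym bi) (sym bsi) (λ ()) , to (hopped⇔swapped b c o i<n bi bsi) occs
  forward (o , i<n , inj₂ (bsi , bi , _ , occs)) =
    o , i<n , subst₂ _≢_ (sym bi) (sym bsi) (λ ()) , to (hopped⇔swapped b c o i<n bi bsi) occs

  backward : 1 ≤ i × i < n × Exchanges i b c → ParticleStep n (hop i) (b , bo) (c , c-so)
  backward (o , i<n , bi≢bsi , c≡) = by-occ (occ b i) refl
    where
    by-occ : ∀ x → occ b i ≡ x → ParticleStep n (hop i) (b , bo) (c , c-so)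
    by-occ true bi = o , i<n , inj₁ (bi , bsi , b-i+2 , occs)
      where
      bsi : occ b (suc i) ≡ false
      bsi = ¬-not (bi≢bsi ∘ trans bi ∘ sym)
      occs : ∀ j → occ c j ≡ (if j ≟ℕ i then false else if j ≟ℕ suc i then true else occ b j)
      occs = from (hopped⇔swapped b c o i<n bi bsi) c≡
      b-i+2 : occ b (i + 2) ≡ false
      b-i+2 = begin
        occ b (i + 2)       ≡⟨ cong (occ b) (ℕP.+-comm i 2) ⟩
        occ b (suc (suc i)) ≡⟨ sym (trans (occs (suc (suc i)))
                                 (trans (if-≟ℕ-≢ (≢-sym (ℕP.m≢1+n+m i {1})))
                                        (if-≟ℕ-≢ (ℕP.1+n≢n {suc i})))) ⟩
        occ c (suc (suc i)) ≡⟨ spreadOut-occ {b = c} (suc i) c-so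
                                 (trans (occs (suc i))
                                        (trans (if-≟ℕ-≢ (ℕP.1+n≢n {i})) (if-≟ℕ-refl (suc i)))) ⟩
        false               ∎
    by-occ false bi = o , i<n , inj₂ (bsi , bi , b-k , occs)
      where
      bsi : occ b (suc i) ≡ true
      bsi = ¬-not (bi≢bsi ∘ trans bi ∘ sym)
      occs : ∀ j → occ c j ≡ (if j ≟ℕ i then true else if j ≟ℕ suc i then false else occ b j)
      occs = from (hopped⇔swapped b c o i<n bi bsi) c≡
      b-k : occ b k ≡ false
      b-k = begin
        occ b k ≡⟨ sym (trans (occs k)
                     (trans (if-≟ℕ-≢ (≢-sym (ℕP.1+n≢n {k}))) (if-≟ℕ-≢ (ℕP.m≢1+n+m k {1})))) ⟩
        occ c k ≡⟨ spreadOut-occ′ {b = c} k c-so (trans (occs i) (if-≟ℕ-refl i)) ⟩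
        false   ∎

occ-verticalLinks-just : ∀ {n} (ds : Vec Dir n) j {d} → dir ds j ≡ just d →
                         occ (verticalLinks ds) j ≡ isVertical d
occ-verticalLinks-just ds j ds-j = trans (occ-verticalLinks ds j) (cong (maybe′ isVertical false) ds-j)

occ-verticalLinks-cong : ∀ {n} (ds ds′ : Vec Dir n) j j′ → dir ds j ≡ dir ds′ j′ →
                         occ (verticalLinks ds) j ≡ occ (verticalLinks ds′) j′
occ-verticalLinks-cong ds ds′ j j′ e =
  trans (occ-verticalLinks ds j)
    (trans (cong (maybe′ isVertical false) e) (sym (occ-verticalLinks ds′ j′)))

≢-sameKind⇒vertical : ∀ {d₁ d₂} → d₁ ≢ d₂ → isVertical d₁ ≡ isVertical d₂ →
                      isVertical d₁ ≡ true
≢-sameKind⇒vertical {N}     _     _  = refl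
≢-sameKind⇒vertical {S}     _     _  = refl
≢-sameKind⇒vertical {E} {E} d₁≢d₂ _  = contradiction refl d₁≢d₂
≢-sameKind⇒vertical {E} {N} _     ()
≢-sameKind⇒vertical {E} {S} _     ()

adjacent-links-differ : ∀ {n i} (u : ArmState n) → 1 ≤ i → i < n →
                        dir (proj₁ u) i ≢ dir (proj₁ u) (suc i) → occ (links u) i ≢ occ (links u) (suc i)
adjacent-links-differ {i = i} u 1≤i i<n dirs≢ occs≡
  with at-inRange 1≤i (ℕP.<⇒≤ i<n) (proj₁ u) | at-inRange (s≤s z≤n) i<n (proj₁ u)
... | d₁ , u-i | d₂ , u-si = contradiction
  (trans (sym (spreadOut-occ {b = links u} i (links-spreadOut u) occ-i)) (trans (sym occs≡) occ-i)) λ ()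
  where
  vertical : isVertical d₁ ≡ true
  vertical = ≢-sameKind⇒vertical
    (λ d₁≡d₂ → dirs≢ (trans u-i (trans (cong just d₁≡d₂) (sym u-si))))
    (trans (sym (occ-verticalLinks-just (proj₁ u) i u-i))
           (trans occs≡ (occ-verticalLinks-just (proj₁ u) (suc i) u-si)))
  occ-i : occ (links u) i ≡ true
  occ-i = trans (occ-verticalLinks-just (proj₁ u) i u-i) vertical

armOf-swap : ∀ {n} h i (b : Vec Bool n) → occ b i ≢ occ b (suc i) →
             armOf h (swap i b) ≡ swap i (armOf h b)
armOf-swap h 0             b                   _  = refl
armOf-swap h 1             []                  _  = refl
armOf-swap h 1             (false ∷ [])        _  = refl
armOf-swap h 1             (true ∷ [])         _  = refl
armOf-swap h 1             (false ∷ false ∷ b) ≢  = contradiction refl ≢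
armOf-swap h 1             (true ∷ true ∷ b)   ≢  = contradiction refl ≢
armOf-swap h 1             (false ∷ true ∷ b)  _  = refl
armOf-swap h 1             (true ∷ false ∷ b)  _  = refl
armOf-swap h (suc (suc i)) []                  _  = refl
armOf-swap h (suc (suc i)) (false ∷ b)         ≢  =
  cong (E ∷_) (armOf-swap h (suc i) b (subst₂ _≢_ (occ-∷ false b i) (occ-∷ false b (suc i)) ≢))
armOf-swap h (suc (suc i)) (true ∷ b)          ≢  =
  cong (verticalFrom h ∷_)
       (armOf-swap (not h) (suc i) b (subst₂ _≢_ (occ-∷ true b i) (occ-∷ true b (suc i)) ≢))

armHop⇔ : ∀ {n i} (u v : ArmState n) →
          ArmStep n (hop i) u v ⇔ (1 ≤ i × i < n × Exchanges i (links u) (links v))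
armHop⇔ {n} {i} u v = mk⇔ forward backward
  where
  forward : ArmStep n (hop i) u v → 1 ≤ i × i < n × Exchanges i (links u) (links v)
  forward (1≤i , i<n , dirs≢ , dirs) = 1≤i , i<n , adjacent-links-differ u 1≤i i<n dirs≢ , (begin
    links v                          ≡⟨ cong verticalLinks (at-ext (proj₁ v) (swap i (proj₁ u))
                                          λ j → trans (dirs j) (sym (at-swap 1≤i i<n (proj₁ u) j))) ⟩
    verticalLinks (swap i (proj₁ u)) ≡⟨ map-swap isVertical i (proj₁ u) ⟩
    swap i (links u)                 ∎)

  backward : 1 ≤ i × i < n × Exchanges i (links u) (links v) → ArmStep n (hop i) u v
  backward (1≤i , i<n , occs≢ , links≡) =
    1≤i , i<n , occs≢ ∘ occ-verticalLinks-cong (proj₁ u) (proj₁ u) i (suc i) ,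
    λ j → trans (cong (λ w → dir w j) swapped) (at-swap 1≤i i<n (proj₁ u) j)
    where
    swapped : proj₁ v ≡ swap i (proj₁ u)
    swapped = begin
      proj₁ v                        ≡⟨ sym (armOf-links v) ⟩
      armOf false (links v)          ≡⟨ cong (armOf false) links≡ ⟩
      armOf false (swap i (links u)) ≡⟨ armOf-swap false i (links u) occs≢ ⟩
      swap i (armOf false (links u)) ≡⟨ cong (swap i) (armOf-links u) ⟩
      swap i (proj₁ u)               ∎

-- End flips are entries and exits

FlipsLast : ∀ {n} → Vec Bool n → Vec Bool n → Set
FlipsLast {n} b c = occ c n ≡ not (occ b n) × (∀ j → j ≢ n → occ c j ≡ occ b j)

particleEnd⇔ : ∀ {n} (b c : ParticleState n) →
               ParticleStep n end b c ⇔ (1 ≤ n × FlipsLast (proj₁ b) (proj₁ c))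
particleEnd⇔ {zero}  _        _          = mk⇔ (λ { (() , _) }) (λ { (() , _) })
particleEnd⇔ {suc m} (b , bo) (c , c-so) = mk⇔ forward backward
  where
  updated⇔ : ∀ x → (∀ j → occ c j ≡ (if j ≟ℕ suc m then x else occ b j)) ⇔
                   (occ c (suc m) ≡ x × (∀ j → j ≢ suc m → occ c j ≡ occ b j))
  updated⇔ = pointwise-update⇔ (occ b) (occ c) (suc m)

  forward : ParticleStep (suc m) end (b , bo) (c , c-so) → 1 ≤ suc m × FlipsLast b c
  forward (o , inj₁ (bn , _ , occs)) = let (cn , rest) = to (updated⇔ true) occs in
    o , trans cn (sym (cong not bn)) , rest
  forward (o , inj₂ (bn , occs))     = let (cn , rest) = to (updated⇔ false) occs in
    o , trans cn (sym (cong not bn)) , rest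

  backward : 1 ≤ suc m × FlipsLast b c → ParticleStep (suc m) end (b , bo) (c , c-so)
  backward (o , cn , rest) = by-occ (occ b (suc m)) refl
    where
    by-occ : ∀ x → occ b (suc m) ≡ x → ParticleStep (suc m) end (b , bo) (c , c-so)
    by-occ false bn = o , inj₁ (bn , bm , from (updated⇔ true) (cn′ , rest))
      where
      cn′ : occ c (suc m) ≡ true
      cn′ = trans cn (cong not bn)
      bm : occ b m ≡ false
      bm = trans (sym (rest m (≢-sym (ℕP.1+n≢n {m})))) (spreadOut-occ′ {b = c} m c-so cn′)
    by-occ true  bn = o , inj₂ (bn , from (updated⇔ false) (trans cn (cong not bn) , rest))

Rot90⇒flips : ∀ {a d} → Rot90 a d → isVertical d ≡ not (isVertical a)
Rot90⇒flips EN = refl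
Rot90⇒flips ES = refl
Rot90⇒flips NE = refl
Rot90⇒flips SE = refl

flips⇒Rot90 : ∀ a d → isVertical d ≡ not (isVertical a) → Rot90 a d
flips⇒Rot90 E N _  = EN
flips⇒Rot90 E S _  = ES
flips⇒Rot90 N E _  = NE
flips⇒Rot90 S E _  = SE
flips⇒Rot90 E E ()
flips⇒Rot90 N N ()
flips⇒Rot90 N S ()
flips⇒Rot90 S N ()
flips⇒Rot90 S S ()

dir-∷-cong : ∀ {n} d (w w′ : Vec Dir n) j → dir w j ≡ dir w′ j →
             dir (d ∷ w) (suc j) ≡ dir (d ∷ w′) (suc j)
dir-∷-cong d w w′ zero    _ = refl
dir-∷-cong d w w′ (suc j) e = e

occ-agree-∷ : ∀ {n j} x y (b c : Vec Bool n) →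
              (∀ k → k ≤ suc j → occ (x ∷ b) k ≡ occ (y ∷ c) k) →
              ∀ k → k ≤ j → occ b k ≡ occ c k
occ-agree-∷ x y b c agree zero    _   = refl
occ-agree-∷ x y b c agree (suc k) k≤j =
  trans (sym (occ-∷ x b k)) (trans (agree (suc (suc k)) (s≤s k≤j)) (occ-∷ y c k))

armOf-prefix : ∀ {n} h (b c : Vec Bool n) j → (∀ k → k ≤ j → occ b k ≡ occ c k) →
               dir (armOf h b) j ≡ dir (armOf h c) j
armOf-prefix h b           c           zero    _     = refl
armOf-prefix h []          []          (suc j) _     = refl
armOf-prefix h (false ∷ b) (false ∷ c) (suc j) agree =
  dir-∷-cong E (armOf h b) (armOf h c) j (armOf-prefix h b c j (occ-agree-∷ false false b c agree))
armOf-prefix h (true ∷ b)  (true ∷ c)  (suc j) agree =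
  dir-∷-cong (verticalFrom h) (armOf (not h) b) (armOf (not h) c) j
    (armOf-prefix (not h) b c j (occ-agree-∷ true true b c agree))
armOf-prefix h (false ∷ b) (true ∷ c)  (suc j) agree = contradiction (agree 1 (s≤s z≤n)) λ ()
armOf-prefix h (true ∷ b)  (false ∷ c) (suc j) agree = contradiction (agree 1 (s≤s z≤n)) λ ()

links-agree⇒dirs-agree : ∀ {n} (u v : ArmState n) →
                         (∀ j → j ≢ n → occ (links v) j ≡ occ (links u) j) →
                         ∀ j → j ≢ n → dir (proj₁ v) j ≡ dir (proj₁ u) j
links-agree⇒dirs-agree {n} u v agree j j≢n with ℕP.<-cmp j n
... | tri< j<n _ _ = begin
  dir (proj₁ v) j               ≡⟨ cong (λ w → dir w j) (sym (armOf-links v)) ⟩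
  dir (armOf false (links v)) j ≡⟨ armOf-prefix false (links v) (links u) j
                                     (λ k k≤j → agree k (ℕP.<⇒≢ (ℕP.≤-<-trans k≤j j<n))) ⟩
  dir (armOf false (links u)) j ≡⟨ cong (λ w → dir w j) (armOf-links u) ⟩
  dir (proj₁ u) j               ∎
... | tri≈ _ j≡n _ = contradiction j≡n j≢n
... | tri> _ _ n<j = trans (at-outOfRange n<j (proj₁ v)) (sym (at-outOfRange n<j (proj₁ u)))

armEnd⇔ : ∀ {n} (u v : ArmState n) → ArmStep n end u v ⇔ (1 ≤ n × FlipsLast (links u) (links v))
armEnd⇔ {n} u v = mk⇔ forward backward
  where
  forward : ArmStep n end u v → 1 ≤ n × FlipsLast (links u) (links v)
  forward (1≤n , (a , d , u-n , v-n , rot) , same) = 1≤n , (begin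
    occ (links v) n     ≡⟨ occ-verticalLinks-just (proj₁ v) n v-n ⟩
    isVertical d        ≡⟨ Rot90⇒flips rot ⟩
    not (isVertical a)  ≡⟨ cong not (sym (occ-verticalLinks-just (proj₁ u) n u-n)) ⟩
    not (occ (links u) n) ∎) ,
    λ j j≢n → occ-verticalLinks-cong (proj₁ v) (proj₁ u) j j (same j j≢n)

  backward : 1 ≤ n × FlipsLast (links u) (links v) → ArmStep n end u v
  backward (1≤n , flipped , same)
    with at-inRange 1≤n ℕP.≤-refl (proj₁ u) | at-inRange 1≤n ℕP.≤-refl (proj₁ v)
  ... | a , u-n | d , v-n = 1≤n ,
    (a , d , u-n , v-n , flips⇒Rot90 a d (begin
      isVertical d          ≡⟨ sym (occ-verticalLinks-just (proj₁ v) n v-n) ⟩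
      occ (links v) n       ≡⟨ flipped ⟩
      not (occ (links u) n) ≡⟨ cong not (occ-verticalLinks-just (proj₁ u) n u-n) ⟩
      not (isVertical a)    ∎)) ,
    links-agree⇒dirs-agree u v same

proposition3p7 : (n : ℕ) → 1 ≤ n → CubicalIso (arm n) (particles n)
proposition3p7 n _ = cubicalIso {arm n} {particles n} refl arm↔particles preserves
  where
  preserves : PreservesSteps (arm n) (particles n) arm↔particles
  preserves (hop i) u v = ⇔.trans (armHop⇔ u v) (⇔.sym (particleHop⇔ (toParticles u) (toParticles v)))
  preserves end     u v = ⇔.trans (armEnd⇔ u v) (⇔.sym (particleEnd⇔ (toParticles u) (toParticles v)))
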